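{- Let $p\ge1$, let $n_1,\dots,n_p\ge1$ and $k_s\in[n_s]$ for each $s\in[p]$. If $\mathcal{F}\subseteq\prod_s\binom{[n_s]}{k_s}$ is intersecting and shifted, then $P(F)\cap P(G)\neq\emptyset$ for all $F,G\in\mathcal{F}$.
   Context: Multi-part setting: the ground set is the disjoint union $\bigsqcup_{s=1}^p[n_s]$; a subset is written $\bigsqcup_sF_s$ with $F_s\subseteq[n_s]$, and $\prod_s\binom{[n_s]}{k_s}$ is the family of all subsets with exactly $k_s$ elements in each part $s$. A family is intersecting if any two members share an element of the ground set (i.e. $F_s\cap G_s\neq\emptyset$ for some $s$). Shifting: for $t\in[p]$, $1\le i<j\le n_t$ and $F=\bigsqcup_sF_s$, $S^{i,j}_t(F)=F$ if $i\in F_t$ or $j\notin F_t$; otherwise $S^{i,j}_t(F)$ replaces $F_t$ by $(F_t\setminus\{j\})\cup\{i\}$. For a family, $S^{i,j}_t(\mathcal{F})=\{S^{i,j}_t(F):F\in\mathcal{F}\}\cup\{F:F\in\mathcal{F},\ S^{i,j}_t(F)\in\mathcal{F}\}$. $\mathcal{F}$ is shifted if $S^{i,j}_t(\mathcal{F})=\mathcal{F}$ for all $t\in[p]$ and all $1\le i<j\le n_t$. Projection: for $F=\bigsqcup_sF_s$, $P_s(F)=F_s\cap[2k_s]$ and $P(F)=\bigsqcup_sP_s(F)$ (the elements of $F$ among the first $2k_s$ elements of each part $s$). -}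

module Defs where

open import Data.Nat using (ℕ; zero; suc; _*_; _<ᵇ_)
open import Data.Fin using (Fin; zero; suc; toℕ; _<_)
open import Data.Fin.Subset using (Subset; _∈_; _∉_; _∩_; ∣_∣)
open import Data.Vec using (tabulate; _[_]≔_)
open import Data.Bool using (Bool; true; false; if_then_else_; _∨_; not)
open import Data.Unit using (⊤; tt)
open import Data.Product using (Σ; _×_; _,_; ∃-syntax)
open import Data.Sum using (_⊎_)
open import Relation.Binary.PropositionalEquality using (_≡_)
open import Function using (_∘_)

-- A subset of the disjoint union ⨆_{s<p} [n_s], stored as a tuple of
-- parts (F_0 , F_1 , … , F_{p-1}) with F_s ⊆ Fin (n s).
-- Element x ∈ Fin (n s) represents the element (toℕ x + 1) of [n_s].
MSet : (p : ℕ) → (Fin p → ℕ) → Set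
MSet zero    n = ⊤
MSet (suc p) n = Subset (n zero) × MSet p (n ∘ suc)

part : {p : ℕ} {n : Fin p → ℕ} → MSet p n → (s : Fin p) → Subset (n s)
part {suc p} (A , F) zero    = A
part {suc p} (A , F) (suc s) = part F s

updateAt : {p : ℕ} {n : Fin p → ℕ} (t : Fin p) →
           (Subset (n t) → Subset (n t)) → MSet p n → MSet p n
updateAt {suc p} zero    f (A , F) = f A , F
updateAt {suc p} (suc t) f (A , F) = A , updateAt t f F

mapParts : {p : ℕ} {n : Fin p → ℕ} →
           ((s : Fin p) → Subset (n s) → Subset (n s)) → MSet p n → MSet p n
mapParts {zero}  f tt      = tt
mapParts {suc p} f (A , F) = f zero A , mapParts (f ∘ suc) F

shiftSub : {m : ℕ} → Fin m → Fin m → Subset m → Subset m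
shiftSub i j A with Data.Vec.lookup A i | Data.Vec.lookup A j
... | false | true = (A [ j ]≔ false) [ i ]≔ true
... | _     | _    = A

S : {p : ℕ} {n : Fin p → ℕ} (t : Fin p) → Fin (n t) → Fin (n t) →
    MSet p n → MSet p n
S t i j = updateAt t (shiftSub i j)

Family : (p : ℕ) → (Fin p → ℕ) → Set₁
Family p n = MSet p n → Set

ShiftFam : {p : ℕ} {n : Fin p → ℕ} (t : Fin p) → Fin (n t) → Fin (n t) →
           Family p n → Family p n
ShiftFam t i j 𝓕 G = (Σ _ λ F → 𝓕 F × S t i j F ≡ G) ⊎ (𝓕 G × 𝓕 (S t i j G))

Shifted : {p : ℕ} {n : Fin p → ℕ} → Family p n → Set
Shifted {p} {n} 𝓕 = (t : Fin p) (i j : Fin (n t)) → i < j → (G : MSet p n) →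
  (ShiftFam t i j 𝓕 G → 𝓕 G) × (𝓕 G → ShiftFam t i j 𝓕 G)

InProduct : {p : ℕ} {n : Fin p → ℕ} → (Fin p → ℕ) → Family p n → Set
InProduct {p} k 𝓕 = ∀ F → 𝓕 F → (s : Fin p) → ∣ part F s ∣ ≡ k s

Meet : {p : ℕ} {n : Fin p → ℕ} → MSet p n → MSet p n → Set
Meet {p} {n} F G = ∃[ s ] ∃[ x ] (x ∈ part F s × x ∈ part G s)

Intersecting : {p : ℕ} {n : Fin p → ℕ} → Family p n → Set
Intersecting 𝓕 = ∀ F G → 𝓕 F → 𝓕 G → Meet F G

-- [m] ⊆ [n] as a subset: elements with toℕ x < m, i.e. {1,…,m}
firstN : (n m : ℕ) → Subset n
firstN n m = tabulate (λ x → toℕ x <ᵇ m)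

P : {p : ℕ} {n : Fin p → ℕ} → (Fin p → ℕ) → MSet p n → MSet p n
P {n = n} k = mapParts (λ s A → A ∩ firstN (n s) (2 * k s))

-- Fix F ∈ 𝓕 and induct on the weight (the sum of the elements) of G ∈ 𝓕.
-- F and G share some x in a part s; if x ∈ [2k_s] we are done.  Otherwise
-- F_s and G_s each have fewer than k_s elements in [2k_s], so some
-- i ∈ [2k_s] lies in both or in neither of them.  In the first case we are
-- done; in the second, shiftedness puts G' = S^{i,x}_s(G) into 𝓕, G' has
-- smaller weight, and since i ∉ F every element of P(F) ∩ P(G') also lies
-- in P(G).
module Submission where

open import Defs
open import Data.Nat using (ℕ; _≤_)
open import Data.Fin using (Fin)

open import Data.Nat using (zero; suc; _+_; _*_; _<_; _<?_; z≤n; s≤s; s≤s⁻¹)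
open import Data.Nat.Properties hiding (_≟_)
open import Data.Nat.Induction using (<-wellFounded)
open import Induction.WellFounded using (Acc; acc)
open import Data.Fin using (toℕ; zero; suc; _≟_)
open import Data.Fin.Properties using (toℕ<n)
open import Data.Fin.Subset using (Subset; _∈_; _∩_; ∣_∣; inside; outside)
open import Data.Fin.Subset.Properties using (p⊆q⇒∣p∣≤∣q∣; p∩q⊆p; x∈p∩q⁺)
open import Data.Vec using ([]; _∷_; lookup; _[_]≔_; here; there)
open import Data.Vec.Properties using ([]=⇒lookup; lookup⇒[]=; lookup∘tabulate; lookup∘update; lookup∘update′)
open import Data.Bool using (true; false; if_then_else_)
open import Data.Bool.Properties using (T-≡)
open import Data.Unit using (tt)
open import Data.Product using (_×_; _,_; proj₁; ∃-syntax)
open import Data.Sum using (inj₁)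
open import Function using (_∘_)
open import Function.Bundles using (Equivalence)
open import Relation.Binary.PropositionalEquality
open import Relation.Nullary using (yes; no; ¬_; contradiction)
open import Algebra.Properties.CommutativeSemigroup +-commutativeSemigroup using (xy∙z≈zy∙x)

private
  variable
    m p : ℕ
    n : Fin p → ℕ

∈-firstN⁺ : ∀ {L} {x : Fin m} → toℕ x < L → x ∈ firstN m L
∈-firstN⁺ {m} {L} {x} x<L =
  lookup⇒[]= x (firstN m L) (trans (lookup∘tabulate _ x) (Equivalence.to T-≡ (<⇒<ᵇ x<L)))

∣p∩firstN∣<∣p∣ : ∀ {L} {x : Fin m} (A : Subset m) →
                 x ∈ A → L ≤ toℕ x → ∣ A ∩ firstN m L ∣ < ∣ A ∣
∣p∩firstN∣<∣p∣ {L = zero}  (inside ∷ A)  here     _         = s≤s (p⊆q⇒∣p∣≤∣q∣ (p∩q⊆p A _))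
∣p∩firstN∣<∣p∣ {L = zero}  (outside ∷ A) (there x∈A) _      = ∣p∩firstN∣<∣p∣ A x∈A z≤n
∣p∩firstN∣<∣p∣ {L = zero}  (inside ∷ A)  (there x∈A) _      = m<n⇒m<1+n (∣p∩firstN∣<∣p∣ A x∈A z≤n)
∣p∩firstN∣<∣p∣ {L = suc L} (outside ∷ A) (there x∈A) (s≤s L≤x) = ∣p∩firstN∣<∣p∣ A x∈A L≤x
∣p∩firstN∣<∣p∣ {L = suc L} (inside ∷ A)  (there x∈A) (s≤s L≤x) = s≤s (∣p∩firstN∣<∣p∣ A x∈A L≤x)

agree-below : ∀ L (A B : Subset m) → L ≤ m →
              ∣ A ∩ firstN m L ∣ + ∣ B ∩ firstN m L ∣ < L →
              ∃[ i ] (toℕ i < L × lookup A i ≡ lookup B i)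
agree-below (suc L) (true  ∷ A) (true  ∷ B) _ _ = zero , s≤s z≤n , refl
agree-below (suc L) (false ∷ A) (false ∷ B) _ _ = zero , s≤s z≤n , refl
agree-below (suc L) (true  ∷ A) (false ∷ B) (s≤s L≤m) (s≤s small)
  with agree-below L A B L≤m small
... | i , i<L , agree = suc i , s≤s i<L , agree
agree-below (suc L) (false ∷ A) (true  ∷ B) (s≤s L≤m) small
  with agree-below L A B L≤m (s≤s⁻¹ (subst (_< suc L) (+-suc _ _) small))
... | i , i<L , agree = suc i , s≤s i<L , agree

agree-below-2k : ∀ {k} {x y : Fin m} (A B : Subset m) → ∣ A ∣ ≡ k → ∣ B ∣ ≡ k →
                 x ∈ A → 2 * k ≤ toℕ x → y ∈ B → 2 * k ≤ toℕ y →
                 ∃[ i ] (toℕ i < 2 * k × lookup A i ≡ lookup B i)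
agree-below-2k {m} {k} {x} A B ∣A∣≡k ∣B∣≡k x∈A 2k≤x y∈B 2k≤y =
  agree-below (2 * k) A B (<⇒≤ (≤-<-trans 2k≤x (toℕ<n x)))
    (≤-trans (+-mono-< (small A ∣A∣≡k x∈A 2k≤x) (small B ∣B∣≡k y∈B 2k≤y))
             (≤-reflexive (cong (k +_) (sym (+-identityʳ k)))))
  where
  small : ∀ {z} (C : Subset m) → ∣ C ∣ ≡ k → z ∈ C → 2 * k ≤ toℕ z →
          ∣ C ∩ firstN m (2 * k) ∣ < k
  small C ∣C∣≡k z∈C 2k≤z = subst (∣ C ∩ firstN m (2 * k) ∣ <_) ∣C∣≡k (∣p∩firstN∣<∣p∣ C z∈C 2k≤z)

weightFrom : ℕ → Subset m → ℕ
weightFrom o []      = 0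
weightFrom o (b ∷ A) = (if b then o else 0) + weightFrom (suc o) A

weight : Subset m → ℕ
weight = weightFrom 0

weightFrom-[]≔ : ∀ o (A : Subset m) j {a} b → lookup A j ≡ a →
                 weightFrom o (A [ j ]≔ b) + (if a then o + toℕ j else 0) ≡
                 weightFrom o A + (if b then o + toℕ j else 0)
weightFrom-[]≔ o (a ∷ A) zero b refl rewrite +-identityʳ o =
  xy∙z≈zy∙x (if b then o else 0) (weightFrom (suc o) A) (if a then o else 0)
weightFrom-[]≔ o (a ∷ A) (suc j) b Aj≡a rewrite +-suc o (toℕ j) =
  trans (+-assoc c _ _)
        (trans (cong (c +_) (weightFrom-[]≔ (suc o) A j b Aj≡a)) (sym (+-assoc c _ _)))
  where c = if a then o else 0

shiftSub-≡ : ∀ {i j : Fin m} (A : Subset m) → lookup A i ≡ false → lookup A j ≡ true →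
             shiftSub i j A ≡ (A [ j ]≔ false) [ i ]≔ true
shiftSub-≡ A Ai Aj rewrite Ai | Aj = refl

weight-shiftSub-< : ∀ {i j : Fin m} (A : Subset m) → lookup A i ≡ false → lookup A j ≡ true →
                    toℕ i < toℕ j → weight (shiftSub i j A) < weight A
weight-shiftSub-< {i = i} {j} A Ai Aj i<j rewrite shiftSub-≡ A Ai Aj = begin-strict
  weight (A′ [ i ]≔ true)  ≡⟨ +-identityʳ _ ⟨
  weight (A′ [ i ]≔ true) + 0
    ≡⟨ weightFrom-[]≔ 0 A′ i true (trans (lookup∘update′ i≢j A false) Ai) ⟩
  weight A′ + toℕ i        <⟨ +-monoʳ-< (weight A′) i<j ⟩
  weight A′ + toℕ j        ≡⟨ weightFrom-[]≔ 0 A j false Aj ⟩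
  weight A + 0             ≡⟨ +-identityʳ _ ⟩
  weight A                 ∎
  where
  open ≤-Reasoning
  A′ = A [ j ]≔ false
  i≢j : ¬ i ≡ j
  i≢j refl = <-irrefl refl i<j

∈-shiftSub⁻ : ∀ {i j y : Fin m} {A : Subset m} → lookup A i ≡ false → lookup A j ≡ true →
              y ∈ shiftSub i j A → ¬ y ≡ i → y ∈ A
∈-shiftSub⁻ {j = j} {y} {A} Ai Aj y∈ y≢i rewrite shiftSub-≡ A Ai Aj with y ≟ j
... | yes refl = contradiction (trans (sym (lookup∘update y A false)) y∈A′) λ ()
  where y∈A′ = trans (sym (lookup∘update′ y≢i (A [ y ]≔ false) true)) ([]=⇒lookup y∈)
... | no y≢j = lookup⇒[]= y A
  (trans (sym (lookup∘update′ y≢j A false))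
         (trans (sym (lookup∘update′ y≢i (A [ j ]≔ false) true)) ([]=⇒lookup y∈)))

part-updateAt : ∀ (t : Fin p) f (G : MSet p n) → part (updateAt t f G) t ≡ f (part G t)
part-updateAt {p = suc p} zero    f (A , G) = refl
part-updateAt {p = suc p} (suc t) f (A , G) = part-updateAt t f G

part-updateAt-≢ : ∀ {s t : Fin p} f (G : MSet p n) → ¬ s ≡ t →
                  part (updateAt t f G) s ≡ part G s
part-updateAt-≢ {p = suc p} {s = zero}  {zero}  f (A , G) s≢t = contradiction refl s≢t
part-updateAt-≢ {p = suc p} {s = zero}  {suc t} f (A , G) s≢t = refl
part-updateAt-≢ {p = suc p} {s = suc s} {zero}  f (A , G) s≢t = refl
part-updateAt-≢ {p = suc p} {s = suc s} {suc t} f (A , G) s≢t =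
  part-updateAt-≢ f G (s≢t ∘ cong suc)

part-mapParts : ∀ f (F : MSet p n) s → part (mapParts f F) s ≡ f s (part F s)
part-mapParts {p = suc p} f (A , F) zero    = refl
part-mapParts {p = suc p} f (A , F) (suc s) = part-mapParts (f ∘ suc) F s

Weight : MSet p n → ℕ
Weight {p = zero}  tt      = 0
Weight {p = suc p} (A , G) = weight A + Weight G

Weight-updateAt-< : ∀ (t : Fin p) f (G : MSet p n) →
                    weight (f (part G t)) < weight (part G t) → Weight (updateAt t f G) < Weight G
Weight-updateAt-< {p = suc p} zero    f (A , G) lt = +-monoˡ-< (Weight G) lt
Weight-updateAt-< {p = suc p} (suc t) f (A , G) lt = +-monoʳ-< (weight A) (Weight-updateAt-< t f G lt)

Weight-S-< : ∀ {t : Fin p} {i j} (G : MSet p n) →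
             lookup (part G t) i ≡ false → lookup (part G t) j ≡ true → toℕ i < toℕ j →
             Weight (S t i j G) < Weight G
Weight-S-< {t = t} {i} {j} G Gi Gj i<j =
  Weight-updateAt-< t (shiftSub i j) G (weight-shiftSub-< (part G t) Gi Gj i<j)

S-closed : ∀ {𝓕 : Family p n} → Shifted 𝓕 → ∀ {G} t {i j} → toℕ i < toℕ j →
           𝓕 G → 𝓕 (S t i j G)
S-closed shifted {G} t {i} {j} i<j G∈𝓕 =
  proj₁ (shifted t i j i<j (S t i j G)) (inj₁ (G , G∈𝓕 , refl))

MeetBelow : (Fin p → ℕ) → MSet p n → MSet p n → Set
MeetBelow L F G = ∃[ s ] ∃[ x ] (x ∈ part F s × x ∈ part G s × toℕ x < L s)

MeetBelow-S⁻ : ∀ {L} {F G : MSet p n} {t i j} →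
               lookup (part F t) i ≡ false → lookup (part G t) i ≡ false →
               lookup (part G t) j ≡ true → MeetBelow L F (S t i j G) → MeetBelow L F G
MeetBelow-S⁻ {G = G} {t} {i} {j} Fi Gi Gj (s , y , y∈F , y∈G′ , y<L) with s ≟ t
... | no s≢t = s , y , y∈F , subst (y ∈_) (part-updateAt-≢ (shiftSub i j) G s≢t) y∈G′ , y<L
... | yes refl = s , y , y∈F , ∈-shiftSub⁻ Gi Gj y∈shift y≢i , y<L
  where
  y∈shift = subst (y ∈_) (part-updateAt s (shiftSub i j) G) y∈G′
  y≢i : ¬ y ≡ i
  y≢i refl = contradiction (trans (sym ([]=⇒lookup y∈F)) Fi) λ ()

MeetBelow⇒Meet : ∀ {L} {F G : MSet p n} → MeetBelow L F G →
                 Meet (mapParts (λ s A → A ∩ firstN (n s) (L s)) F)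
                      (mapParts (λ s A → A ∩ firstN (n s) (L s)) G)
MeetBelow⇒Meet {F = F} {G} (s , x , x∈F , x∈G , x<L) =
  s , x , below F x∈F , below G x∈G
  where
  below : ∀ H → x ∈ part H s → x ∈ part (mapParts _ H) s
  below H x∈H = subst (x ∈_) (sym (part-mapParts _ H s)) (x∈p∩q⁺ (x∈H , ∈-firstN⁺ x<L))

module _ {k : Fin p → ℕ} {𝓕 : Family p n} (𝓕⊆ : InProduct k 𝓕) (intersecting : Intersecting 𝓕)
         (shifted : Shifted 𝓕) {F : MSet p n} (F∈𝓕 : 𝓕 F) where

  meetBelow : ∀ G → 𝓕 G → Acc _<_ (Weight G) → MeetBelow (λ s → 2 * k s) F G
  meetBelow G G∈𝓕 (acc lighter) with intersecting F G F∈𝓕 G∈𝓕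
  ... | s , x , x∈F , x∈G with toℕ x <? 2 * k s
  ...   | yes x<2k = s , x , x∈F , x∈G , x<2k
  ...   | no x≮2k
    with agree-below-2k (part F s) (part G s) (𝓕⊆ F F∈𝓕 s) (𝓕⊆ G G∈𝓕 s)
                        x∈F (≮⇒≥ x≮2k) x∈G (≮⇒≥ x≮2k)
  ...     | i , i<2k , Fi≡Gi with lookup (part F s) i in Fi
  ...       | true  = s , i , lookup⇒[]= i _ Fi , lookup⇒[]= i _ (sym Fi≡Gi) , i<2k
  ...       | false =
    MeetBelow-S⁻ Fi (sym Fi≡Gi) Gx
      (meetBelow (S s i x G) (S-closed shifted s i<x G∈𝓕) (lighter (Weight-S-< G (sym Fi≡Gi) Gx i<x)))
    where
    Gx = []=⇒lookup x∈G
    i<x = <-≤-trans i<2k (≮⇒≥ x≮2k)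

lemma3p1 : (p : ℕ) → 1 ≤ p → (n k : Fin p → ℕ) →
    (∀ s → 1 ≤ n s) → (∀ s → 1 ≤ k s) → (∀ s → k s ≤ n s) →
    (𝓕 : Family p n) → InProduct k 𝓕 → Intersecting 𝓕 → Shifted 𝓕 →
    ∀ F G → 𝓕 F → 𝓕 G → Meet (P k F) (P k G)
lemma3p1 p _ n k _ _ _ 𝓕 𝓕⊆ intersecting shifted F G F∈𝓕 G∈𝓕 =
  MeetBelow⇒Meet (meetBelow 𝓕⊆ intersecting shifted F∈𝓕 G G∈𝓕 (<-wellFounded (Weight G)))
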